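{- Let $G$ be a finite, simple, connected graph with maximum degree $\Delta(G)$ and clique number $\omega(G)$. If $k\ge \Delta(G)$, then $\mathrm{f}\mu^{k}(G)=\omega(G)$.
   Context: For an integer $k\ge 0$, a set $X\subseteq V(G)$ is a $k$-fault-tolerant mutual-visibility set ($k$-ftmv set) if for any two non-adjacent vertices $u,v\in X$ there exist $k+1$ internally vertex-disjoint shortest $u,v$-paths $Q_1,\dots,Q_{k+1}$ in $G$ such that $V(Q_i)\cap X=\{u,v\}$ for every $i$. $\mathrm{f}\mu^{k}(G)$ denotes the maximum cardinality of a $k$-ftmv set of $G$. -}

module Defs where

open import Data.Nat using (ℕ; suc; _≤_)
open import Data.Bool using (Bool; true; false; T)
open import Data.Fin using (Fin)
open import Data.Fin.Subset using (Subset; _∈_; ∣_∣)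
open import Data.List using (List; []; _∷_; length)
open import Data.List.Membership.Propositional renaming (_∈_ to _∈ₗ_)
open import Data.List.Relation.Unary.Unique.Propositional using (Unique)
open import Data.Vec using (tabulate)
open import Data.Product using (Σ; ∃; _×_; _,_)
open import Data.Sum using (_⊎_)
open import Relation.Binary.PropositionalEquality using (_≡_; _≢_)

record Graph (n : ℕ) : Set where
  field
    adj    : Fin n → Fin n → Bool
    sym    : ∀ u v → adj u v ≡ adj v u
    irrefl : ∀ u → adj u u ≡ false

module _ {n : ℕ} (G : Graph n) where
  open Graph G

  Edge : Fin n → Fin n → Set
  Edge u v = T (adj u v)

  data Walk : Fin n → Fin n → List (Fin n) → Set where
    here : ∀ {u} → Walk u u (u ∷ [])
    step : ∀ {u w v p} → Edge u w → Walk w v p → Walk u v (u ∷ p)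

  IsPath : Fin n → Fin n → List (Fin n) → Set
  IsPath u v p = Walk u v p × Unique p

  IsShortestPath : Fin n → Fin n → List (Fin n) → Set
  IsShortestPath u v p = IsPath u v p × (∀ q → IsPath u v q → length p ≤ length q)

  Connected : Set
  Connected = ∀ u v → ∃ λ p → Walk u v p

  N : Fin n → Subset n
  N v = tabulate (adj v)

  degree : Fin n → ℕ
  degree v = ∣ N v ∣

  IsMaxDegree : ℕ → Set
  IsMaxDegree Δ = (∃ λ v → degree v ≡ Δ) × (∀ v → degree v ≤ Δ)

  IsClique : Subset n → Set
  IsClique X = ∀ u v → u ∈ X → v ∈ X → u ≢ v → Edge u v

  IsFTMV : ℕ → Subset n → Set
  IsFTMV k X =
    ∀ u v → u ∈ X → v ∈ X → u ≢ v → ¬Edge u v →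
      Σ (Fin (suc k) → List (Fin n)) λ Q →
        (∀ i → IsShortestPath u v (Q i))
        × (∀ i j → i ≢ j → ∀ w → w ∈ₗ Q i → w ∈ₗ Q j → w ≡ u ⊎ w ≡ v)
        × (∀ i w → w ∈ₗ Q i → w ∈ X → w ≡ u ⊎ w ≡ v)
    where
      ¬Edge : Fin n → Fin n → Set
      ¬Edge a b = adj a b ≡ false

IsMaxCard : {n : ℕ} → (Subset n → Set) → ℕ → Set
IsMaxCard {n} P m = (∃ λ X → P X × ∣ X ∣ ≡ m) × (∀ X → P X → ∣ X ∣ ≤ m)

CliqueNumber : {n : ℕ} → Graph n → ℕ → Set
CliqueNumber G m = IsMaxCard (IsClique G) m

FTMVNumber : {n : ℕ} → Graph n → ℕ → ℕ → Set
FTMVNumber G k m = IsMaxCard (IsFTMV G k) m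

{-# OPTIONS --safe #-}
-- If u, v ∈ X are non-adjacent, each of the k + 1 internally disjoint u,v-paths
-- leaves u through a different neighbour of u, so k + 1 ≤ deg u ≤ Δ ≤ k, which is
-- absurd. Hence for k ≥ Δ the k-ftmv sets are exactly the cliques (the latter
-- satisfy the definition vacuously), and the two maxima coincide.
module Submission where

open import Defs
open import Data.Nat using (ℕ; _≤_; zero; suc; z≤n)
open import Data.Nat.Properties using (≤-trans; ≤-<-trans; 1+n≰n)
open import Data.Bool using (true; false; T)
open import Data.Bool.Properties using (T-≡)
open import Data.Fin using (Fin)
open import Data.Fin.Properties using (_≟_; 0≢1+n; suc-injective)
open import Data.Fin.Subset using (Subset; _∈_; ∣_∣; _-_)
open import Data.Fin.Subset.Properties using (x∈p∧x≢y⇒x∈p-y; x∈p⇒∣p-x∣<∣p∣)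
open import Data.Vec.Properties using (lookup⇒[]=; lookup∘tabulate)
open import Data.List using (List)
open import Data.List.Membership.Propositional renaming (_∈_ to _∈ₗ_)
open import Data.List.Relation.Unary.Any using (here; there)
open import Data.Product using (∃; _×_; _,_; proj₁; proj₂)
open import Data.Sum using (_⊎_; [_,_])
open import Data.Empty using (⊥-elim)
open import Data.Unit using (tt)
open import Function using (_∘_; Equivalence)
open import Function.Definitions using (Injective)
open import Relation.Nullary using (¬_)
open import Relation.Nullary.Decidable using (decidable-stable)
open import Relation.Binary.PropositionalEquality using (_≡_; _≢_; refl; sym; trans; subst)

injective⇒≤∣p∣ : ∀ {m n} {p : Subset n} (f : Fin m → Fin n) →
  Injective _≡_ _≡_ f → (∀ i → f i ∈ p) → m ≤ ∣ p ∣
injective⇒≤∣p∣ {zero}  f _   _   = z≤n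
injective⇒≤∣p∣ {suc m} f inj f∈p =
  ≤-<-trans (injective⇒≤∣p∣ (f ∘ Fin.suc) (suc-injective ∘ inj) tail∈p-f0)
            (x∈p⇒∣p-x∣<∣p∣ (f∈p Fin.zero))
  where
  tail∈p-f0 : ∀ i → f (Fin.suc i) ∈ _ - f Fin.zero
  tail∈p-f0 i = x∈p∧x≢y⇒x∈p-y (f∈p (Fin.suc i)) (0≢1+n ∘ sym ∘ inj)

module _ {n : ℕ} (G : Graph n) where
  open Graph G using (adj; irrefl)

  Edge⇒∈N : ∀ {u w} → Edge G u w → w ∈ N G u
  Edge⇒∈N {u} {w} e =
    lookup⇒[]= w _ (trans (lookup∘tabulate (adj u) w) (Equivalence.to T-≡ e))

  ¬Edge-refl : ∀ {u} → ¬ Edge G u u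
  ¬Edge-refl {u} = subst T (irrefl u)

  walk-head : ∀ {u v p} → Walk G u v p → u ∈ₗ p
  walk-head here       = here refl
  walk-head (step _ _) = here refl

  walk⇒first-step : ∀ {u v p} → u ≢ v → Walk G u v p → ∃ λ w → Edge G u w × w ∈ₗ p
  walk⇒first-step u≢v here        = ⊥-elim (u≢v refl)
  walk⇒first-step u≢v (step e wk) = _ , e , there (walk-head wk)

  disjoint-walks⇒≤degree : ∀ {m u v} → u ≢ v → adj u v ≡ false →
    (Q : Fin m → List (Fin n)) → (∀ i → Walk G u v (Q i)) →
    (∀ i j → i ≢ j → ∀ w → w ∈ₗ Q i → w ∈ₗ Q j → w ≡ u ⊎ w ≡ v) →
    m ≤ degree G u
  disjoint-walks⇒≤degree {m} {u} {v} u≢v uv∉E Q walk disjoint =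
    injective⇒≤∣p∣ next next-injective (Edge⇒∈N ∘ next-edge)
    where
    next : Fin m → Fin n
    next i = proj₁ (walk⇒first-step u≢v (walk i))

    next-edge : ∀ i → Edge G u (next i)
    next-edge i = proj₁ (proj₂ (walk⇒first-step u≢v (walk i)))

    next∈Q : ∀ i → next i ∈ₗ Q i
    next∈Q i = proj₂ (proj₂ (walk⇒first-step u≢v (walk i)))

    next-inner : ∀ i → ¬ (next i ≡ u ⊎ next i ≡ v)
    next-inner i = [ (λ eq → ¬Edge-refl (edge-to eq))
                   , (λ eq → subst T uv∉E (edge-to eq)) ]
      where
      edge-to : ∀ {w} → next i ≡ w → Edge G u w
      edge-to eq = subst (Edge G u) eq (next-edge i)

    next-injective : Injective _≡_ _≡_ next
    next-injective {i} {j} eq = decidable-stable (i ≟ j) λ i≢j →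
      next-inner i (disjoint i j i≢j _ (next∈Q i) (subst (_∈ₗ Q j) (sym eq) (next∈Q j)))

  ftmv⇒clique : ∀ {k X} → (∀ v → degree G v ≤ k) → IsFTMV G k X → IsClique G X
  ftmv⇒clique deg≤k ftmv u v u∈X v∈X u≢v with adj u v in uv
  ... | true  = tt
  ... | false =
    let (Q , shortest , disjoint , _) = ftmv u v u∈X v∈X u≢v uv in
    ⊥-elim (1+n≰n (≤-trans (disjoint-walks⇒≤degree u≢v uv Q (proj₁ ∘ proj₁ ∘ shortest) disjoint)
                           (deg≤k u)))

  clique⇒ftmv : ∀ {k X} → IsClique G X → IsFTMV G k X
  clique⇒ftmv clique u v u∈X v∈X u≢v uv∉E = ⊥-elim (subst T uv∉E (clique u v u∈X v∈X u≢v))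

proposition3p2 : (n : ℕ) (G : Graph n) → Connected G →
    (Δ ω k : ℕ) → IsMaxDegree G Δ → CliqueNumber G ω → Δ ≤ k →
    FTMVNumber G k ω
proposition3p2 n G _ Δ ω k (_ , deg≤Δ) ((X , X-clique , ∣X∣≡ω) , clique-max) Δ≤k =
  (X , clique⇒ftmv G X-clique , ∣X∣≡ω) ,
  λ Y Y-ftmv → clique-max Y (ftmv⇒clique G deg≤k Y-ftmv)
  where
  deg≤k : ∀ v → degree G v ≤ k
  deg≤k v = ≤-trans (deg≤Δ v) Δ≤k
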